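{- Let $n\ge 4$ and let $M_n(2)=\langle a,b\mid a^{2^{n-1}}=b^2=1,\ bab^{ -1}=a^{1+2^{n-2}}\rangle$ be the modular maximal-cyclic group of order $2^n$. Then $w(M_n(2))=2(n-1)$.
   Context: For a finite group $G$, a $G$-transfer system is a partial order $\to$ on the set $\operatorname{Sub}(G)$ of subgroups of $G$ such that: (i) $K\to H$ implies $K\le H$; (ii) $H\to H$ for all $H$; (iii) $L\to K$ and $K\to H$ imply $L\to H$; (iv) $K\to H$ and $L\le H$ imply $K\cap L\to H\cap L$; (v) $K\to H$ implies $gKg^{ -1}\to gHg^{ -1}$ for all $g\in G$. A set $S$ of pairs $(K,H)$ with $K\le H$ generates the smallest transfer system containing $S$. The complete $G$-transfer system is the one with $K\to H$ for all $K\le H$. The width $w(G)$ is the minimal cardinality of a set generating the complete $G$-transfer system. -}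

module Defs where

open import Level using (0ℓ)
open import Data.Nat using (ℕ; zero; suc; _+_; _*_; _∸_; _^_; _≤_; NonZero)
open import Data.Nat.Properties using (m^n≢0)
open import Data.Nat.DivMod using (_mod_; _%_)
open import Data.Fin using (Fin; toℕ)
open import Data.Bool using (Bool; true; false; T; _∧_)
open import Data.Product using (_×_; _,_; Σ; ∃)
open import Data.List using (List; length)
open import Data.List.Membership.Propositional using (_∈_)
open import Data.List.Relation.Unary.All using (All)
open import Relation.Binary.PropositionalEquality using (_≡_)

record GroupData : Set₁ where
  field
    Carrier : Set
    _·_     : Carrier → Carrier → Carrier
    e       : Carrier
    inv     : Carrier → Carrier

module _ (G : GroupData) where
  open GroupData G

  SubsetG : Set
  SubsetG = Carrier → Bool

  _⊆_ : SubsetG → SubsetG → Set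
  K ⊆ H = ∀ x → T (K x) → T (H x)

  _≐_ : SubsetG → SubsetG → Set
  K ≐ H = (K ⊆ H) × (H ⊆ K)

  _∩_ : SubsetG → SubsetG → SubsetG
  (K ∩ L) x = K x ∧ L x

  -- conj g K = g K g⁻¹ : x ∈ g K g⁻¹ iff g⁻¹ x g ∈ K
  conj : Carrier → SubsetG → SubsetG
  conj g K x = K ((inv g · x) · g)

  record IsSubgroup (H : SubsetG) : Set where
    field
      has-e   : T (H e)
      has-·   : ∀ x y → T (H x) → T (H y) → T (H (x · y))
      has-inv : ∀ x → T (H x) → T (H (inv x))

  ValidGens : List (SubsetG × SubsetG) → Set
  ValidGens S = All (λ { (K , H) → IsSubgroup K × IsSubgroup H × (K ⊆ H) }) S

  -- The transfer system generated by S: the smallest relation on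
  -- subgroups (taken up to extensional equality) containing S and closed
  -- under reflexivity, transitivity, restriction and conjugation.
  data Gen (S : List (SubsetG × SubsetG)) : SubsetG → SubsetG → Set where
    base     : ∀ {K H} → (K , H) ∈ S → Gen S K H
    refl     : ∀ {H} → IsSubgroup H → Gen S H H
    trans    : ∀ {L K H} → Gen S L K → Gen S K H → Gen S L H
    restrict : ∀ {K H L} → Gen S K H → IsSubgroup L → L ⊆ H →
               Gen S (K ∩ L) (H ∩ L)
    conjugate : ∀ {K H} (g : Carrier) → Gen S K H → Gen S (conj g K) (conj g H)
    resp     : ∀ {K K′ H H′} → K ≐ K′ → H ≐ H′ → Gen S K H → Gen S K′ H′

  GeneratesComplete : List (SubsetG × SubsetG) → Set
  GeneratesComplete S =
    ∀ K H → IsSubgroup K → IsSubgroup H → K ⊆ H → Gen S K H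

  -- w(G) = w : minimal cardinality of a generating set of the complete
  -- transfer system.  (Lists may repeat entries; this does not change
  -- the minimum.)
  HasWidth : ℕ → Set
  HasWidth w =
    (Σ (List (SubsetG × SubsetG)) λ S →
       ValidGens S × GeneratesComplete S × length S ≡ w)
    × (∀ S → ValidGens S → GeneratesComplete S → w ≤ length S)

-- Element (i , j) stands for a^i b^j, i mod 2^(n-1), j mod 2.
-- Since b a b⁻¹ = a^r with r = 1 + 2^(n-2), we have b^j a^k = a^(k r^j) b^j:
--   (a^i b^j)(a^k b^l) = a^(i + k r^j) b^(j + l)
--   (a^i b^j)⁻¹ = b^(-j) a^(-i) = a^(-i r^j) b^j     (using b² = 1).

module _ (n : ℕ) where
  private
    N : ℕ
    N = 2 ^ (n ∸ 1)
    instance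
      N≢0 : NonZero N
      N≢0 = m^n≢0 2 (n ∸ 1)
    r : ℕ
    r = 1 + 2 ^ (n ∸ 2)

  M-Carrier : Set
  M-Carrier = Fin N × Fin 2

  M-mul : M-Carrier → M-Carrier → M-Carrier
  M-mul (i , j) (k , l) =
    ((toℕ i + toℕ k * r ^ toℕ j) mod N , (toℕ j + toℕ l) mod 2)

  M-e : M-Carrier
  M-e = (0 mod N , 0 mod 2)

  M-inv : M-Carrier → M-Carrier
  M-inv (i , j) = ((N ∸ ((toℕ i * r ^ toℕ j) % N)) mod N , j)

M : ℕ → GroupData
M n = record
  { Carrier = M-Carrier n
  ; _·_     = M-mul n
  ; e       = M-e n
  ; inv     = M-inv n
  }

-- Call a pair K ≤ H an escape over (K₀, x) if K₀ ⊆ K and x ∈ H \ K.  When K₀ is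
-- normal and every conjugate of x lies in K₀x, the transfer-system operations never create an
-- escape out of pairs that are not escapes, so a generating set of the complete transfer system
-- must itself contain an escape.  In M_n(2) every conjugate of y is y or zy, where z = a^(2^(n-2))
-- is central, and the 2(n-1) choices (1, z), (⟨a⟩, b), (⟨a^(2^(t+1)), b⟩, a^(2^t)) and
-- (⟨a^(2^(t+1)), a^(2^t) b⟩, a^(2^t)) for t ≤ n-3 are such that no pair escapes over two of them.
--
-- The pairs (C, G) for C = ⟨a⟩, ⟨a^(2^p), b⟩ (1 ≤ p ≤ n-1) and ⟨a^(2^(p+1)), a^(2^p) b⟩
-- (p ≤ n-3) generate everything: restricting C → G along L gives C ∩ L → L, so K → H follows by
-- intersecting H with one such C ⊇ K missing x for each x ∉ K.  Such a C exists because a subgroup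
-- K with K ∩ ⟨a⟩ = ⟨a^(2^p)⟩ lies in ⟨a⟩, or equals ⟨a^(2^p), b⟩, or equals ⟨a^(2^p), a^(2^(p-1)) b⟩;
-- the last one for p = n-1 is the a-conjugate of ⟨b⟩.
module Submission where

open import Level using (0ℓ)
open import Algebra.Bundles using (Group)
open import Algebra.Structures using (IsGroup)
import Algebra.Properties.Group as GroupProperties
open import Data.Bool using (true; false; T; _∧_)
open import Data.Bool.Properties using (T-∧)
open import Data.Fin as Fin using (Fin; zero; suc; toℕ; remQuot; combine)
open import Data.Fin.Properties using (toℕ-injective; toℕ-fromℕ<; toℕ<n; any?; injective⇒≤; combine-remQuot)
open import Data.List using (List; []; _∷_; _++_; length; lookup; applyUpTo; allFin; cartesianProduct)
open import Data.List.Properties using (length-++; length-applyUpTo)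
open import Data.List.Membership.Propositional using (_∈_)
open import Data.List.Membership.Propositional.Properties
  using (∈-++⁺ˡ; ∈-++⁺ʳ; ∈-applyUpTo⁺; ∈-allFin; ∈-cartesianProduct⁺)
open import Data.List.Relation.Unary.All as All using (All; all?; _∷_)
open import Data.List.Relation.Unary.All.Properties using (¬All⇒Any¬; ++⁺; applyUpTo⁺₁)
open import Data.List.Relation.Unary.Any as Any using (Any; here; there)
open import Data.List.Relation.Unary.Any.Properties using (lookup-result)
open import Data.Nat using (ℕ; zero; suc; _+_; _*_; _∸_; _^_; _≤_; _<_; z≤n; s≤s; NonZero; _≤?_)
open import Data.Nat.Properties
  using (+-comm; +-assoc; +-suc; +-identityʳ; *-comm; *-assoc; *-identityˡ; *-identityʳ; *-zeroʳ;
         *-distribʳ-+; ^-distribˡ-+-*; ^-monoʳ-<; m^n≢0; ≤-refl; ≤-trans; ≤-pred; <⇒≤; <⇒≱; ≰⇒>; n<1+n;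
         n≮n; ≤∧≢⇒<; m<m+n; m≤n⇒m≤1+n; m<1+n⇒m<n∨m≡n; m+[n∸m]≡n; m∸n+n≡m; <-cmp)
open import Data.Nat.DivMod
  using (_mod_; _%_; _/_; m≡m%n+[m/n]*n; m%n≤n; %-distribˡ-+; %-distribˡ-*; m%n%n≡m%n; [m+kn]%n≡m%n; m<n⇒m%n≡m)
open import Data.Nat.Divisibility
  using (_∣_; divides; _∣?_; _∣0; 1∣_; ∣-refl; ∣-trans; ∣⇒≤; %-presˡ-∣; ∣n∣m%n⇒∣m; ∣m∣n⇒∣m+n; ∣m+n∣m⇒∣n;
         ∣m⇒∣m*n; ∣n⇒∣m*n; m∣m*n; n∣m*n; *-pres-∣; *-cancelˡ-∣)
open import Data.Nat.Induction using (<-wellFounded)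
open import Data.Nat.Tactic.RingSolver using (solve-∀)
open import Data.Product using (∃-syntax; _×_; _,_; proj₁; proj₂; uncurry)
open import Data.Product.Properties using (≡-dec)
open import Data.Sum using (_⊎_; inj₁; inj₂)
open import Function using (_∘_; Injective; Equivalence)
open import Induction.WellFounded using (Acc; acc)
open import Relation.Binary.Definitions using (DecidableEquality; tri<; tri≈; tri>)
open import Relation.Binary.PropositionalEquality as ≡
  using (_≡_; refl; sym; cong; cong₂; subst; module ≡-Reasoning)
open import Relation.Nullary using (¬_; Dec; yes; no; contradiction)
open import Relation.Nullary.Decidable
  using (⌊_⌋; toWitness; fromWitness; map′; T?; ¬?; _×-dec_; _→-dec_; decidable-stable)
open import Defs hiding (_⊆_; _≐_; _∩_)
import Defs

T-∧⁺ : ∀ {a b} → T a → T b → T (a ∧ b)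
T-∧⁺ a b = Equivalence.from T-∧ (a , b)

T-∧⁻ˡ : ∀ {a b} → T (a ∧ b) → T a
T-∧⁻ˡ = proj₁ ∘ Equivalence.to T-∧

T-∧⁻ʳ : ∀ {a b} → T (a ∧ b) → T b
T-∧⁻ʳ = proj₂ ∘ Equivalence.to T-∧

-- Arithmetic

toℕ-mod : ∀ i d .{{_ : NonZero d}} → toℕ (i mod d) ≡ i % d
toℕ-mod i d = toℕ-fromℕ< _

mod-cong : ∀ {d i k} .{{_ : NonZero d}} → i % d ≡ k % d → i mod d ≡ k mod d
mod-cong {d} {i} {k} eq = toℕ-injective (≡.trans (toℕ-mod i d) (≡.trans eq (sym (toℕ-mod k d))))

mod-≡ : ∀ {d i k} .{{_ : NonZero d}} c c′ → i + c * d ≡ k + c′ * d → i mod d ≡ k mod d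
mod-≡ {d} {i} {k} c c′ eq = mod-cong (begin
  i % d            ≡⟨ sym ([m+kn]%n≡m%n i c d) ⟩
  (i + c * d) % d  ≡⟨ cong (_% d) eq ⟩
  (k + c′ * d) % d ≡⟨ [m+kn]%n≡m%n k c′ d ⟩
  k % d            ∎)
  where open ≡-Reasoning

∣-∸ : ∀ {d a b} → b ≤ a → d ∣ a → d ∣ b → d ∣ a ∸ b
∣-∸ {d} b≤a d∣a d∣b = ∣m+n∣m⇒∣n (subst (d ∣_) (sym (m+[n∸m]≡n b≤a)) d∣a) d∣b

2^-monoʳ-∣ : ∀ {p k} → p ≤ k → 2 ^ p ∣ 2 ^ k
2^-monoʳ-∣ {p} {k} p≤k =
  subst (2 ^ p ∣_) (≡.trans (sym (^-distribˡ-+-* 2 p (k ∸ p))) (cong (2 ^_) (m+[n∸m]≡n p≤k))) (m∣m*n (2 ^ (k ∸ p)))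

2^suc∤2^ : ∀ t → ¬ 2 ^ suc t ∣ 2 ^ t
2^suc∤2^ t d = <⇒≱ (^-monoʳ-< 2 (s≤s (s≤s z≤n)) (n<1+n t)) (∣⇒≤ {{m^n≢0 2 t}} d)

even-or-odd : ∀ u → ∃[ w ] (u ≡ 2 * w ⊎ u ≡ 1 + 2 * w)
even-or-odd zero    = 0 , inj₁ refl
even-or-odd (suc u) with even-or-odd u
... | w , inj₁ refl = w , inj₂ refl
... | w , inj₂ refl = suc w , inj₁ (cong suc (sym (+-suc w (w + 0))))

two-adic : ∀ i → 0 < i → ∃[ v ] ∃[ o ] i ≡ 2 ^ v * (1 + 2 * o)
two-adic i = go i (<-wellFounded i)
  where
    go : ∀ i → Acc _<_ i → 0 < i → ∃[ v ] ∃[ o ] i ≡ 2 ^ v * (1 + 2 * o)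
    go i (acc rec) 0<i with even-or-odd i
    ... | o , inj₂ refl = 0 , o , sym (+-identityʳ _)
    ... | w , inj₁ refl with go w (rec (half< w 0<i)) (0<half w 0<i)
      where
        0<half : ∀ w → 0 < 2 * w → 0 < w
        0<half (suc w) _ = s≤s z≤n
        half< : ∀ w → 0 < 2 * w → w < 2 * w
        half< (suc w) _ = m<m+n (suc w) (s≤s z≤n)
    ... | v , o , refl = suc v , o , sym (*-assoc 2 (2 ^ v) _)

odd-inverse : ∀ s o → ∃[ t ] ∃[ c ] t * (1 + 2 * o) ≡ 1 + c * 2 ^ s
odd-inverse zero    o = 1 , 2 * o , one-inverse o
  where
    one-inverse : ∀ o → 1 * (1 + 2 * o) ≡ 1 + 2 * o * 1
    one-inverse = solve-∀
odd-inverse (suc s) o with odd-inverse s o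
... | t , c , eq with even-or-odd c
...   | w , inj₁ refl = t , w , ≡.trans eq (regroup w (2 ^ s))
  where
    regroup : ∀ w X → 1 + 2 * w * X ≡ 1 + w * (2 * X)
    regroup = solve-∀
...   | w , inj₂ refl = t + 2 ^ s , 1 + w + o ,
                        ≡.trans (*-distribʳ-+ (1 + 2 * o) t (2 ^ s))
                                (≡.trans (cong (_+ 2 ^ s * (1 + 2 * o)) eq) (lift w o (2 ^ s)))
  where
    lift : ∀ w o X → 1 + (1 + 2 * w) * X + X * (1 + 2 * o) ≡ 1 + (1 + w + o) * (2 * X)
    lift = solve-∀

∣-cancel-odd : ∀ k m o → 2 ^ k ∣ m * (1 + 2 * o) → 2 ^ k ∣ m
∣-cancel-odd k m o ∣m*odd with odd-inverse k o
... | t , c , eq = ∣m+n∣m⇒∣n (subst (2 ^ k ∣_) expand (∣n⇒∣m*n t ∣m*odd)) (n∣m*n (m * c))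
  where
    expand : t * (m * (1 + 2 * o)) ≡ m * c * 2 ^ k + m
    expand = begin
      t * (m * (1 + 2 * o)) ≡⟨ swap t m (1 + 2 * o) ⟩
      m * (t * (1 + 2 * o)) ≡⟨ cong (m *_) eq ⟩
      m * (1 + c * 2 ^ k)   ≡⟨ distribute m c (2 ^ k) ⟩
      m * c * 2 ^ k + m     ∎
      where
        open ≡-Reasoning
        swap : ∀ t m u → t * (m * u) ≡ m * (t * u)
        swap = solve-∀
        distribute : ∀ m c X → m * (1 + c * X) ≡ m * c * X + m
        distribute = solve-∀

least-satisfying : ∀ {P : ℕ → Set} → (∀ q → Dec (P q)) → ∀ {k} → P k → ∃[ p ] P p × (∀ {q} → P q → p ≤ q)
least-satisfying {P} P? {k} Pk with search (suc k)
  where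
    search : ∀ k → (∀ {q} → P q → k ≤ q) ⊎ ∃[ p ] P p × (∀ {q} → P q → p ≤ q)
    search zero    = inj₁ λ _ → z≤n
    search (suc k) with search k
    ... | inj₂ least   = inj₂ least
    ... | inj₁ above-k with P? k
    ...   | yes Pk = inj₂ (k , Pk , above-k)
    ...   | no ¬Pk = inj₁ λ {q} Pq → ≤∧≢⇒< (above-k Pq) λ { refl → ¬Pk Pq }
... | inj₁ above-k = contradiction (above-k Pk) (n≮n k)
... | inj₂ least   = least

-- Transfer systems of a finite group

module TransferSystems
  (G : GroupData)
  (isGroup : IsGroup _≡_ (GroupData._·_ G) (GroupData.e G) (GroupData.inv G))
  where

  open GroupData G
  open IsGroup isGroup using (assoc; identityˡ; identityʳ; inverseˡ; inverseʳ)

  group : Group 0ℓ 0ℓ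
  group = record { isGroup = isGroup }

  open GroupProperties group
    using (inverseˡ-unique; ⁻¹-anti-homo-∙; ⁻¹-involutive; \\-leftDividesʳ; //-rightDividesˡ)

  Subset : Set
  Subset = SubsetG G

  infix 4 _⊆_ _≐_
  infixr 7 _∩_

  _⊆_ : Subset → Subset → Set
  _⊆_ = Defs._⊆_ G

  _≐_ : Subset → Subset → Set
  _≐_ = Defs._≐_ G

  _∩_ : Subset → Subset → Subset
  _∩_ = Defs._∩_ G

  Full : Subset
  Full _ = true

  Full-isSubgroup : IsSubgroup G Full
  Full-isSubgroup = record { has-e = _ ; has-· = λ _ _ _ _ → _ ; has-inv = λ _ _ → _ }

  ∩-isSubgroup : ∀ {K L} → IsSubgroup G K → IsSubgroup G L → IsSubgroup G (K ∩ L)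
  ∩-isSubgroup sK sL = record
    { has-e   = T-∧⁺ (K.has-e) (L.has-e)
    ; has-·   = λ x y x∈ y∈ → T-∧⁺ (K.has-· x y (T-∧⁻ˡ x∈) (T-∧⁻ˡ y∈)) (L.has-· x y (T-∧⁻ʳ x∈) (T-∧⁻ʳ y∈))
    ; has-inv = λ x x∈ → T-∧⁺ (K.has-inv x (T-∧⁻ˡ x∈)) (L.has-inv x (T-∧⁻ʳ x∈))
    }
    where
      module K = IsSubgroup sK
      module L = IsSubgroup sL

  isSubgroup-resp-≐ : ∀ {K L} → K ≐ L → IsSubgroup G K → IsSubgroup G L
  isSubgroup-resp-≐ (K⊆L , L⊆K) sK = record
    { has-e   = K⊆L _ has-e
    ; has-·   = λ x y x∈ y∈ → K⊆L _ (has-· x y (L⊆K x x∈) (L⊆K y y∈))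
    ; has-inv = λ x x∈ → K⊆L _ (has-inv x (L⊆K x x∈))
    }
    where open IsSubgroup sK

  preimage-isSubgroup : ∀ {K} (φ : Carrier → Carrier) → φ e ≡ e →
                        (∀ x y → φ (x · y) ≡ φ x · φ y) →
                        IsSubgroup G K → IsSubgroup G (K ∘ φ)
  preimage-isSubgroup {K} φ φ-e φ-· sK = record
    { has-e   = subst (T ∘ K) (sym φ-e) has-e
    ; has-·   = λ x y x∈ y∈ → subst (T ∘ K) (sym (φ-· x y)) (has-· _ _ x∈ y∈)
    ; has-inv = λ x x∈ → subst (T ∘ K) (sym (φ-inv x)) (has-inv _ x∈)
    }
    where
      open IsSubgroup sK
      φ-inv : ∀ x → φ (inv x) ≡ inv (φ x)
      φ-inv x = inverseˡ-unique _ _ (≡.trans (sym (φ-· (inv x) x)) (≡.trans (cong φ (inverseˡ x)) φ-e))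

  conjugate-by : Carrier → Carrier → Carrier
  conjugate-by g x = (inv g · x) · g

  conjugate-by-e : ∀ g → conjugate-by g e ≡ e
  conjugate-by-e g = ≡.trans (cong (_· g) (identityʳ (inv g))) (inverseˡ g)

  conjugate-by-· : ∀ g x y → conjugate-by g (x · y) ≡ conjugate-by g x · conjugate-by g y
  conjugate-by-· g x y = begin
    (inv g · (x · y)) · g               ≡⟨ cong (_· g) (sym (assoc (inv g) x y)) ⟩
    ((inv g · x) · y) · g               ≡⟨ assoc (inv g · x) y g ⟩
    (inv g · x) · (y · g)               ≡⟨ cong (λ u → (inv g · x) · (u · g)) (sym (identityˡ y)) ⟩
    (inv g · x) · ((e · y) · g)         ≡⟨ cong (λ u → (inv g · x) · ((u · y) · g)) (sym (inverseʳ g)) ⟩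
    (inv g · x) · (((g · inv g) · y) · g) ≡⟨ cong (λ u → (inv g · x) · (u · g)) (assoc g (inv g) y) ⟩
    (inv g · x) · ((g · (inv g · y)) · g) ≡⟨ cong ((inv g · x) ·_) (assoc g (inv g · y) g) ⟩
    (inv g · x) · (g · ((inv g · y) · g)) ≡⟨ sym (assoc (inv g · x) g _) ⟩
    ((inv g · x) · g) · ((inv g · y) · g) ∎
    where open ≡-Reasoning

  conj-isSubgroup : ∀ {K} g → IsSubgroup G K → IsSubgroup G (conj G g K)
  conj-isSubgroup g = preimage-isSubgroup (conjugate-by g) (conjugate-by-e g) (conjugate-by-· g)

  Gen⇒subgroups : ∀ {S K H} → ValidGens G S → Gen G S K H →
                   IsSubgroup G K × IsSubgroup G H × K ⊆ H
  Gen⇒subgroups valid (base mem) = All.lookup valid mem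
  Gen⇒subgroups valid (refl sH) = sH , sH , λ _ x∈ → x∈
  Gen⇒subgroups valid (trans L→K K→H)
    with Gen⇒subgroups valid L→K | Gen⇒subgroups valid K→H
  ... | sL , _ , L⊆K | _ , sH , K⊆H = sL , sH , λ x x∈ → K⊆H x (L⊆K x x∈)
  Gen⇒subgroups valid (restrict K→H sL _) with Gen⇒subgroups valid K→H
  ... | sK , sH , K⊆H = ∩-isSubgroup sK sL , ∩-isSubgroup sH sL ,
                         λ x x∈ → T-∧⁺ (K⊆H x (T-∧⁻ˡ x∈)) (T-∧⁻ʳ x∈)
  Gen⇒subgroups valid (conjugate g K→H) with Gen⇒subgroups valid K→H
  ... | sK , sH , K⊆H = conj-isSubgroup g sK , conj-isSubgroup g sH , λ x → K⊆H _
  Gen⇒subgroups valid (resp (K⊆K′ , K′⊆K) (H⊆H′ , H′⊆H) K→H) with Gen⇒subgroups valid K→H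
  ... | sK , sH , K⊆H = isSubgroup-resp-≐ (K⊆K′ , K′⊆K) sK , isSubgroup-resp-≐ (H⊆H′ , H′⊆H) sH ,
                         λ x x∈ → H⊆H′ x (K⊆H x (K′⊆K x x∈))

  conjugate-by-inverse : ∀ g y → conjugate-by g (conjugate-by (inv g) y) ≡ y
  conjugate-by-inverse g y = begin
    (inv g · ((inv (inv g) · y) · inv g)) · g ≡⟨ cong (λ u → (inv g · ((u · y) · inv g)) · g) (⁻¹-involutive g) ⟩
    (inv g · ((g · y) · inv g)) · g           ≡⟨ assoc (inv g) _ g ⟩
    inv g · (((g · y) · inv g) · g)           ≡⟨ cong (inv g ·_) (//-rightDividesˡ g (g · y)) ⟩
    inv g · (g · y)                           ≡⟨ \\-leftDividesʳ g y ⟩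
    y                                         ∎
    where open ≡-Reasoning

  inv≡·inv-square : ∀ x → inv x ≡ x · inv (x · x)
  inv≡·inv-square x = begin
    inv x                   ≡⟨ sym (identityˡ (inv x)) ⟩
    e · inv x               ≡⟨ cong (_· inv x) (sym (inverseʳ x)) ⟩
    (x · inv x) · inv x     ≡⟨ assoc x (inv x) (inv x) ⟩
    x · (inv x · inv x)     ≡⟨ cong (x ·_) (sym (⁻¹-anti-homo-∙ x x)) ⟩
    x · inv (x · x)         ∎
    where open ≡-Reasoning

  IsNormal : Subset → Set
  IsNormal K₀ = ∀ g y → T (K₀ y) → T (K₀ (conjugate-by g y))

  ConjugatesIn : Subset → Carrier → Set
  ConjugatesIn K₀ x = ∀ g → ∃[ k ] T (K₀ k) × conjugate-by g x ≡ k · x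

  Escapes : Subset → Carrier → Subset → Subset → Set
  Escapes K₀ x K H = K₀ ⊆ K × T (H x) × ¬ T (K x)

  Gen-escape-free : ∀ {K₀ x S K H} → IsNormal K₀ → ConjugatesIn K₀ x → ValidGens G S →
                    All (¬_ ∘ uncurry (Escapes K₀ x)) S → Gen G S K H → ¬ Escapes K₀ x K H
  Gen-escape-free normal conjugates valid free (base mem) = All.lookup free mem
  Gen-escape-free normal conjugates valid free (refl _) (_ , x∈H , x∉H) = x∉H x∈H
  Gen-escape-free {x = x} normal conjugates valid free (trans {K = K} L→K K→H) (K₀⊆L , x∈H , x∉L)
    with K x in eq
  ... | true  = Gen-escape-free normal conjugates valid free L→K (K₀⊆L , subst T (sym eq) _ , x∉L)
  ... | false = Gen-escape-free normal conjugates valid free K→H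
                  ((λ y y∈ → proj₂ (proj₂ (Gen⇒subgroups valid L→K)) y (K₀⊆L y y∈)) , x∈H ,
                   λ x∈K → subst T eq x∈K)
  Gen-escape-free normal conjugates valid free (restrict K→H _ _) (K₀⊆K∩L , x∈H∩L , x∉K∩L) =
    Gen-escape-free normal conjugates valid free K→H
      ((λ y y∈ → T-∧⁻ˡ (K₀⊆K∩L y y∈)) , T-∧⁻ˡ x∈H∩L , λ x∈K → x∉K∩L (T-∧⁺ x∈K (T-∧⁻ʳ x∈H∩L)))
  Gen-escape-free {K₀} {x} normal conjugates valid free (conjugate {K} {H} g K→H) (K₀⊆gK , x∈gH , x∉gK)
    with Gen⇒subgroups valid K→H | conjugates g
  ... | sK , sH , K⊆H | k , k∈K₀ , gx≡kx =
    Gen-escape-free normal conjugates valid free K→H (K₀⊆K , x∈H , x∉K)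
    where
      K₀⊆K : K₀ ⊆ K
      K₀⊆K y y∈ = subst (T ∘ K) (conjugate-by-inverse g y) (K₀⊆gK _ (normal (inv g) y y∈))
      k∈K : T (K k)
      k∈K = K₀⊆K k k∈K₀
      x∈H : T (H x)
      x∈H = subst (T ∘ H) (\\-leftDividesʳ k x)
              (IsSubgroup.has-· sH _ _ (K⊆H _ (IsSubgroup.has-inv sK k k∈K)) (subst (T ∘ H) gx≡kx x∈gH))
      x∉K : ¬ T (K x)
      x∉K x∈K = x∉gK (subst (T ∘ K) (sym gx≡kx) (IsSubgroup.has-· sK k x k∈K x∈K))
  Gen-escape-free normal conjugates valid free (resp (K⊆K′ , K′⊆K) (_ , H′⊆H) K→H) (K₀⊆K′ , x∈H′ , x∉K′) =
    Gen-escape-free normal conjugates valid free K→H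
      ((λ y y∈ → K′⊆K y (K₀⊆K′ y y∈)) , H′⊆H _ x∈H′ , λ x∈K → x∉K′ (K⊆K′ _ x∈K))

  restrict-to : ∀ {S C L} → Gen G S C Full → IsSubgroup G L → Gen G S (C ∩ L) L
  restrict-to C→Full sL = resp ((λ _ x∈ → x∈) , (λ _ x∈ → x∈)) ((λ _ → T-∧⁻ʳ) , (λ _ x∈ → T-∧⁺ _ x∈))
                               (restrict C→Full sL (λ _ _ → _))

  module Finite (elements : List Carrier) (∈-elements : ∀ x → x ∈ elements) where

    _⊆?_ : ∀ K L → Dec (K ⊆ L)
    K ⊆? L = map′ (λ all x → All.lookup all (∈-elements x)) (λ K⊆L → All.tabulate λ {x} _ → K⊆L x)
                  (all? (λ x → T? (K x) →-dec T? (L x)) elements)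

    escapes? : ∀ K₀ x K H → Dec (Escapes K₀ x K H)
    escapes? K₀ x K H = (K₀ ⊆? K) ×-dec T? (H x) ×-dec ¬? (T? (K x))

    -- Every generating set needs, for each index i, its own generator escaping over
    -- (floor i, escapee i).
    record Obstructions (I : Set) : Set₁ where
      field
        floor              : I → Subset
        escapee            : I → Carrier
        floor-isSubgroup   : ∀ i → IsSubgroup G (floor i)
        floor-normal       : ∀ i → IsNormal (floor i)
        escapee-conjugates : ∀ i → ConjugatesIn (floor i) (escapee i)
        escapee∉floor      : ∀ i → ¬ T (floor i (escapee i))
        cover              : ∀ i → ∃[ H ] IsSubgroup G H × floor i ⊆ H × T (H (escapee i))
        disjoint           : ∀ {i j K} → IsSubgroup G K → floor i ⊆ K → floor j ⊆ K →
                             ¬ T (K (escapee i)) → ¬ T (K (escapee j)) → i ≡ j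

    obstructions⇒≤ : ∀ {I k S} → Obstructions I → (ι : Fin k → I) → Injective _≡_ _≡_ ι →
                     ValidGens G S → GeneratesComplete G S → k ≤ length S
    obstructions⇒≤ {I} {k} {S} obstructions ι ι-injective valid complete =
      injective⇒≤ {f = index ∘ ι} (ι-injective ∘ index-injective)
      where
        open Obstructions obstructions
        Obstructed : I → Subset × Subset → Set
        Obstructed i (K , H) = Escapes (floor i) (escapee i) K H
        obstructed? : ∀ i p → Dec (Obstructed i p)
        obstructed? i (K , H) = escapes? (floor i) (escapee i) K H
        escaping-generator : ∀ i → Any (Obstructed i) S
        escaping-generator i = Any.map (λ {p} → decidable-stable (obstructed? i p))
                  (¬All⇒Any¬ (¬? ∘ obstructed? i) S λ free →
                    let (H , sH , floor⊆H , escapee∈H) = cover i in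
                    Gen-escape-free (floor-normal i) (escapee-conjugates i) valid free
                      (complete (floor i) H (floor-isSubgroup i) sH floor⊆H)
                      ((λ _ x∈ → x∈) , escapee∈H , escapee∉floor i))
        index : I → Fin (length S)
        index i = Any.index (escaping-generator i)
        index-injective : ∀ {i j} → index i ≡ index j → i ≡ j
        index-injective {i} {j} eq =
          let (sK , _) , floor-i⊆K , _ , escapee-i∉K = All.lookupAny valid (escaping-generator i)
              floor-j⊆K , _ , escapee-j∉K =
                subst (Obstructed j ∘ lookup S) (sym eq) (lookup-result (escaping-generator j))
          in disjoint sK floor-i⊆K floor-j⊆K escapee-i∉K escapee-j∉K

    record Separator (S : List (Subset × Subset)) (K : Subset) (x : Carrier) : Set where
      field
        C            : Subset
        C-isSubgroup : IsSubgroup G C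
        K⊆C          : K ⊆ C
        x∉C          : ¬ T (C x)
        C→Full       : Gen G S C Full

    module _ {S : List (Subset × Subset)} {K H : Subset} (sH : IsSubgroup G H) (K⊆H : K ⊆ H)
             (separator : ∀ x → ¬ T (K x) → Separator S K x) where

      record Approximation (xs : List Carrier) : Set where
        field
          L            : Subset
          L-isSubgroup : IsSubgroup G L
          K⊆L          : K ⊆ L
          L→H          : Gen G S L H
          exact        : ∀ {x} → x ∈ xs → T (L x) → T (K x)

      approximate : ∀ xs → Approximation xs
      approximate [] = record { L = H ; L-isSubgroup = sH ; K⊆L = K⊆H ; L→H = refl sH ; exact = λ () }
      approximate (x ∷ xs) with K x in eq | approximate xs
      ... | true | A = record
        { Approximation A
        ; exact = λ { (here refl) _ → subst T (sym eq) _ ; (there x∈xs) → exact x∈xs } }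
        where open Approximation A
      ... | false | A = record
        { L = C ∩ L
        ; L-isSubgroup = ∩-isSubgroup C-isSubgroup L-isSubgroup
        ; K⊆L = λ y y∈ → T-∧⁺ (K⊆C y y∈) (K⊆L y y∈)
        ; L→H = trans (restrict-to C→Full L-isSubgroup) L→H
        ; exact = λ { (here refl) x∈ → contradiction (T-∧⁻ˡ x∈) x∉C ; (there x∈xs) x∈ → exact x∈xs (T-∧⁻ʳ x∈) } }
        where
          open Approximation A
          open Separator (separator x λ x∈K → subst T eq x∈K)

    separators⇒complete : ∀ {S} → (∀ K → IsSubgroup G K → ∀ x → ¬ T (K x) → Separator S K x) →
                          GeneratesComplete G S
    separators⇒complete separator K H sK sH K⊆H =
      resp ((λ x → exact (∈-elements x)) , K⊆L) ((λ _ x∈ → x∈) , (λ _ x∈ → x∈)) L→H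
      where open Approximation (approximate sH K⊆H (separator K sK) elements)

-- The group M_n(2)

module ModularGroup (m : ℕ) where

  -- a has order N = 2^(n-1) and b a b⁻¹ = a^r.  Since h = 2q and N = 2h hold definitionally,
  -- ring identities stated in q apply directly to h, N and r.
  n q h N r : ℕ
  n = 4 + m
  q = 2 ^ (1 + m)
  h = 2 ^ (2 + m)
  N = 2 ^ (3 + m)
  r = 1 + h

  instance
    N-nonZero : NonZero N
    N-nonZero = m^n≢0 2 (3 + m)

  open GroupData (M n)

  mk : ℕ → ℕ → Carrier
  mk i j = i mod N , j mod 2

  mk-≡ : ∀ {i k} c c′ j → i + c * N ≡ k + c′ * N → mk i j ≡ mk k j
  mk-≡ c c′ j eq = cong (_, _) (mod-≡ c c′ eq)

  mk-η : ∀ (i : Fin N) (j : Fin 2) → (i , j) ≡ mk (toℕ i) (toℕ j)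
  mk-η i j = cong₂ _,_ (toℕ-injective (sym (≡.trans (toℕ-mod (toℕ i) N) (m<n⇒m%n≡m (toℕ<n i)))))
                       (toℕ-injective (sym (≡.trans (toℕ-mod (toℕ j) 2) (m<n⇒m%n≡m (toℕ<n j)))))

  r²≡1+kN : r * r ≡ 1 + (1 + q) * N
  r²≡1+kN = square q
    where
      square : ∀ q → (1 + 2 * q) * (1 + 2 * q) ≡ 1 + (1 + q) * (2 * (2 * q))
      square = solve-∀

  r^j%N : ∀ j → r ^ j % N ≡ r ^ (j % 2) % N
  r^j%N 0             = refl
  r^j%N 1             = refl
  r^j%N (suc (suc j)) = begin
    r * (r * r ^ j) % N               ≡⟨ cong (_% N) (sym (*-assoc r r (r ^ j))) ⟩
    r * r * r ^ j % N                 ≡⟨ cong (λ u → u * r ^ j % N) r²≡1+kN ⟩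
    (1 + (1 + q) * N) * r ^ j % N     ≡⟨ cong (_% N) (expand (r ^ j) (1 + q) N) ⟩
    (r ^ j + (1 + q) * r ^ j * N) % N ≡⟨ [m+kn]%n≡m%n (r ^ j) ((1 + q) * r ^ j) N ⟩
    r ^ j % N                         ≡⟨ r^j%N j ⟩
    r ^ (j % 2) % N                   ∎
    where
      open ≡-Reasoning
      expand : ∀ x c N → (1 + c * N) * x ≡ x + c * x * N
      expand = solve-∀

  +*-mod : ∀ i k {c c′} → c % N ≡ c′ % N → (i % N + (k % N) * c) % N ≡ (i + k * c′) % N
  +*-mod i k {c} {c′} c≡c′ = begin
    (i % N + (k % N) * c) % N                 ≡⟨ %-distribˡ-+ (i % N) _ N ⟩
    (i % N % N + (k % N) * c % N) % N         ≡⟨ cong₂ (λ u v → (u + v) % N) (m%n%n≡m%n i N) (%-distribˡ-* (k % N) c N) ⟩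
    (i % N + (k % N % N) * (c % N) % N) % N   ≡⟨ cong₂ (λ u v → (i % N + u * v % N) % N) (m%n%n≡m%n k N) c≡c′ ⟩
    (i % N + (k % N) * (c′ % N) % N) % N      ≡⟨ cong (λ u → (i % N + u) % N) (sym (%-distribˡ-* k c′ N)) ⟩
    (i % N + k * c′ % N) % N                  ≡⟨ sym (%-distribˡ-+ i (k * c′) N) ⟩
    (i + k * c′) % N                          ∎
    where open ≡-Reasoning

  mk-· : ∀ i j k l → mk i j · mk k l ≡ mk (i + k * r ^ j) (j + l)
  mk-· i j k l = cong₂ _,_
    (mod-cong {N} {toℕ (i mod N) + toℕ (k mod N) * r ^ toℕ (j mod 2)}
      (≡.trans (cong₂ (λ u v → (u + v * r ^ toℕ (j mod 2)) % N) (toℕ-mod i N) (toℕ-mod k N))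
               (+*-mod i k (≡.trans (cong (λ u → r ^ u % N) (toℕ-mod j 2)) (sym (r^j%N j))))))
    (mod-cong {2} {toℕ (j mod 2) + toℕ (l mod 2)} {j + l}
      (≡.trans (cong₂ (λ u v → (u + v) % 2) (toℕ-mod j 2) (toℕ-mod l 2)) (sym (%-distribˡ-+ j l 2))))

  mul-even : ∀ i k l → mk i 0 · mk k l ≡ mk (i + k) l
  mul-even i k l = ≡.trans (mk-· i 0 k l) (cong (λ u → mk (i + u) l) (*-identityʳ k))

  mul-odd : ∀ i k l → mk i 1 · mk k l ≡ mk (i + k * r) (1 + l)
  mul-odd i k l = ≡.trans (mk-· i 1 k l) (cong (λ u → mk (i + k * u) (1 + l)) (*-identityʳ r))

  mk-assoc : ∀ i j k l t u → (mk i j · mk k l) · mk t u ≡ mk i j · (mk k l · mk t u)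
  mk-assoc i j k l t u = begin
    (mk i j · mk k l) · mk t u                     ≡⟨ cong (_· mk t u) (mk-· i j k l) ⟩
    mk (i + k * r ^ j) (j + l) · mk t u            ≡⟨ mk-· _ (j + l) t u ⟩
    mk (i + k * r ^ j + t * r ^ (j + l)) (j + l + u) ≡⟨ cong₂ mk index-eq (+-assoc j l u) ⟩
    mk (i + (k + t * r ^ l) * r ^ j) (j + (l + u)) ≡⟨ sym (mk-· i j _ _) ⟩
    mk i j · mk (k + t * r ^ l) (l + u)            ≡⟨ cong (mk i j ·_) (sym (mk-· k l t u)) ⟩
    mk i j · (mk k l · mk t u)                     ∎
    where
      open ≡-Reasoning
      reassociate : ∀ i k t A B → i + k * A + t * (A * B) ≡ i + (k + t * B) * A
      reassociate = solve-∀
      index-eq : i + k * r ^ j + t * r ^ (j + l) ≡ i + (k + t * r ^ l) * r ^ j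
      index-eq = ≡.trans (cong (λ u → i + k * r ^ j + t * u) (^-distribˡ-+-* r j l)) (reassociate i k t _ _)

  inv-η : ∀ (i : Fin N) (j : Fin 2) → inv (i , j) ≡ mk (N ∸ (toℕ i * r ^ toℕ j) % N) (toℕ j)
  inv-η i j = cong (proj₁ (inv (i , j)) ,_) (cong proj₂ (mk-η i j))

  N∸w%N+w : ∀ w → N ∸ w % N + w ≡ (1 + w / N) * N
  N∸w%N+w w = begin
    N ∸ w % N + w                   ≡⟨ cong (N ∸ w % N +_) (m≡m%n+[m/n]*n w N) ⟩
    N ∸ w % N + (w % N + w / N * N) ≡⟨ sym (+-assoc (N ∸ w % N) _ _) ⟩
    N ∸ w % N + w % N + w / N * N   ≡⟨ cong (_+ w / N * N) (m∸n+n≡m (m%n≤n w N)) ⟩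
    N + w / N * N                   ∎
    where open ≡-Reasoning

  ·-assoc : ∀ x y w → (x · y) · w ≡ x · (y · w)
  ·-assoc (i , j) (k , l) (t , u) = begin
    ((i , j) · (k , l)) · (t , u) ≡⟨ cong₂ _·_ (cong₂ _·_ (mk-η i j) (mk-η k l)) (mk-η t u) ⟩
    (mk I J · mk K L) · mk T′ U    ≡⟨ mk-assoc I J K L T′ U ⟩
    mk I J · (mk K L · mk T′ U)    ≡⟨ sym (cong₂ _·_ (mk-η i j) (cong₂ _·_ (mk-η k l) (mk-η t u))) ⟩
    (i , j) · ((k , l) · (t , u)) ∎
    where
      open ≡-Reasoning
      I J K L T′ U : ℕ
      I = toℕ i ; J = toℕ j ; K = toℕ k ; L = toℕ l ; T′ = toℕ t ; U = toℕ u

  ·-identityˡ : ∀ x → e · x ≡ x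
  ·-identityˡ (i , j) = begin
    e · (i , j)                   ≡⟨ cong (e ·_) (mk-η i j) ⟩
    mk 0 0 · mk (toℕ i) (toℕ j)   ≡⟨ mul-even 0 (toℕ i) (toℕ j) ⟩
    mk (toℕ i) (toℕ j)            ≡⟨ sym (mk-η i j) ⟩
    (i , j)                       ∎
    where open ≡-Reasoning

  ·-identityʳ : ∀ x → x · e ≡ x
  ·-identityʳ (i , j) = begin
    (i , j) · e                                   ≡⟨ cong (_· e) (mk-η i j) ⟩
    mk (toℕ i) (toℕ j) · mk 0 0                   ≡⟨ mk-· (toℕ i) (toℕ j) 0 0 ⟩
    mk (toℕ i + 0 * r ^ toℕ j) (toℕ j + 0)        ≡⟨ cong₂ mk (+-identityʳ (toℕ i)) (+-identityʳ (toℕ j)) ⟩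
    mk (toℕ i) (toℕ j)                            ≡⟨ sym (mk-η i j) ⟩
    (i , j)                                       ∎
    where open ≡-Reasoning

  ·-inverseˡ : ∀ x → inv x · x ≡ e
  ·-inverseˡ (i , j) = begin
    inv (i , j) · (i , j)                 ≡⟨ cong₂ _·_ (inv-η i j) (mk-η i j) ⟩
    mk (N ∸ w % N) J · mk (toℕ i) J       ≡⟨ mk-· _ J _ J ⟩
    mk (N ∸ w % N + w) (J + J)            ≡⟨ cong₂ _,_ (mod-≡ 0 (1 + w / N) (≡.trans (+-identityʳ _) (N∸w%N+w w)))
                                                       (mod-≡ 0 J (twice J)) ⟩
    e                                     ∎
    where
      open ≡-Reasoning
      twice : ∀ J → J + J + 0 ≡ J * 2
      twice = solve-∀
      J w : ℕ
      J = toℕ j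
      w = toℕ i * r ^ J

  ·-inverseʳ : ∀ x → x · inv x ≡ e
  ·-inverseʳ x = begin
    x · inv x                           ≡⟨ sym (·-identityˡ (x · inv x)) ⟩
    e · (x · inv x)                     ≡⟨ cong (_· (x · inv x)) (sym (·-inverseˡ (inv x))) ⟩
    (inv (inv x) · inv x) · (x · inv x) ≡⟨ ·-assoc (inv (inv x)) (inv x) (x · inv x) ⟩
    inv (inv x) · (inv x · (x · inv x)) ≡⟨ cong (inv (inv x) ·_) (sym (·-assoc (inv x) x (inv x))) ⟩
    inv (inv x) · ((inv x · x) · inv x) ≡⟨ cong (λ u → inv (inv x) · (u · inv x)) (·-inverseˡ x) ⟩
    inv (inv x) · (e · inv x)           ≡⟨ cong (inv (inv x) ·_) (·-identityˡ (inv x)) ⟩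
    inv (inv x) · inv x                 ≡⟨ ·-inverseˡ (inv x) ⟩
    e                                   ∎
    where open ≡-Reasoning

  M-isGroup : IsGroup _≡_ _·_ e inv
  M-isGroup = record
    { isMonoid = record
      { isSemigroup = record
        { isMagma = record { isEquivalence = ≡.isEquivalence ; ∙-cong = cong₂ _·_ }
        ; assoc   = ·-assoc
        }
      ; identity = ·-identityˡ , ·-identityʳ
      }
    ; inverse = ·-inverseˡ , ·-inverseʳ
    ; ⁻¹-cong = cong inv
    }

  open TransferSystems (M n) M-isGroup public
  open GroupProperties group using (\\-leftDividesʳ; //-rightDividesʳ; ε⁻¹≈ε)

  z : Carrier
  z = mk h 0

  infix 30 z^_
  z^_ : ℕ → Carrier
  z^ s = mk (s * h) 0

  r^-bit : ∀ (j : Fin 2) → r ^ toℕ j ≡ 1 + toℕ j * h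
  r^-bit zero       = refl
  r^-bit (suc zero) = ≡.trans (*-identityʳ r) (cong suc (sym (+-identityʳ h)))

  commutator-exponent : Carrier → Carrier → ℕ
  commutator-exponent (i , j) (k , l) = toℕ k * toℕ j + toℕ i * toℕ l

  ·-commute : ∀ x y → x · y ≡ z^ (commutator-exponent x y) · (y · x)
  ·-commute (i , j) (k , l) = begin
    (i , j) · (k , l)                  ≡⟨ cong₂ _·_ (mk-η i j) (mk-η k l) ⟩
    mk I J · mk K L                    ≡⟨ mk-· I J K L ⟩
    mk (I + K * r ^ J) (J + L)         ≡⟨ cong₂ _,_ (mod-≡ (I * L) 0 index-eq) (cong (_mod 2) (+-comm J L)) ⟩
    mk (s * h + (K + I * r ^ L)) (L + J) ≡⟨ sym (mul-even (s * h) _ (L + J)) ⟩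
    z^ s · mk (K + I * r ^ L) (L + J)  ≡⟨ cong (z^ s ·_) (sym (mk-· K L I J)) ⟩
    z^ s · (mk K L · mk I J)           ≡⟨ cong (z^ s ·_) (sym (cong₂ _·_ (mk-η k l) (mk-η i j))) ⟩
    z^ s · ((k , l) · (i , j))         ∎
    where
      open ≡-Reasoning
      I J K L s : ℕ
      I = toℕ i ; J = toℕ j ; K = toℕ k ; L = toℕ l
      s = K * J + I * L
      exponents : ∀ I J K L q → I + K * (1 + J * (2 * q)) + I * L * (2 * (2 * q)) ≡
                            (K * J + I * L) * (2 * q) + (K + I * (1 + L * (2 * q))) + 0 * (2 * (2 * q))
      exponents = solve-∀
      index-eq : I + K * r ^ J + I * L * N ≡ s * h + (K + I * r ^ L) + 0 * N
      index-eq = ≡.trans (cong (λ u → I + K * u + I * L * N) (r^-bit j))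
                   (≡.trans (exponents I J K L q) (cong (λ u → s * h + (K + I * u) + 0 * N) (sym (r^-bit l))))

  z^-central : ∀ s g → z^ s · g ≡ g · z^ s
  z^-central s (k , l) = begin
    z^ s · (k , l)              ≡⟨ cong (z^ s ·_) (mk-η k l) ⟩
    mk (s * h) 0 · mk K L       ≡⟨ mul-even (s * h) K L ⟩
    mk (s * h + K) L            ≡⟨ cong₂ _,_ (mod-≡ (s * L * q) 0 index-eq) (cong (_mod 2) (sym (+-identityʳ L))) ⟩
    mk (K + s * h * r ^ L) (L + 0) ≡⟨ sym (mk-· K L (s * h) 0) ⟩
    mk K L · z^ s               ≡⟨ cong (_· z^ s) (sym (mk-η k l)) ⟩
    (k , l) · z^ s              ∎
    where
      open ≡-Reasoning
      K L : ℕ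
      K = toℕ k ; L = toℕ l
      exponents : ∀ s K L q → s * (2 * q) + K + s * L * q * (2 * (2 * q)) ≡
                          K + s * (2 * q) * (1 + L * (2 * q)) + 0 * (2 * (2 * q))
      exponents = solve-∀
      index-eq : s * h + K + s * L * q * N ≡ K + s * h * r ^ L + 0 * N
      index-eq = ≡.trans (exponents s K L q) (cong (λ u → K + s * h * u + 0 * N) (sym (r^-bit l)))

  conjugate-by≡z^· : ∀ g y → conjugate-by g y ≡ z^ (commutator-exponent y g) · y
  conjugate-by≡z^· g y = begin
    (inv g · y) · g          ≡⟨ ·-assoc (inv g) y g ⟩
    inv g · (y · g)          ≡⟨ cong (inv g ·_) (·-commute y g) ⟩
    inv g · (z^ s · (g · y)) ≡⟨ cong (inv g ·_) (sym (·-assoc (z^ s) g y)) ⟩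
    inv g · ((z^ s · g) · y) ≡⟨ cong (λ u → inv g · (u · y)) (z^-central s g) ⟩
    inv g · ((g · z^ s) · y) ≡⟨ cong (inv g ·_) (·-assoc g (z^ s) y) ⟩
    inv g · (g · (z^ s · y)) ≡⟨ \\-leftDividesʳ g (z^ s · y) ⟩
    z^ s · y                 ∎
    where
      open ≡-Reasoning
      s : ℕ
      s = commutator-exponent y g

  z^1≡z : z^ 1 ≡ z
  z^1≡z = cong (λ u → mk u 0) (*-identityˡ h)

  -- Subgroups of M_n(2)

  module _ {K : Subset} (sK : IsSubgroup (M n) K) where
    open IsSubgroup sK

    multiples-∈ : ∀ {i} → T (K (mk i 0)) → ∀ c → T (K (mk (c * i) 0))
    multiples-∈ i∈ zero    = has-e
    multiples-∈ i∈ (suc c) = subst (T ∘ K) (mul-even _ _ 0) (has-· _ _ i∈ (multiples-∈ i∈ c))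

    z∈⇒normal : T (K z) → IsNormal K
    z∈⇒normal z∈ g y y∈ =
      subst (T ∘ K) (sym (conjugate-by≡z^· g y)) (has-· _ y (multiples-∈ z∈ (commutator-exponent y g)) y∈)

    z∈⇒conjugatesIn : T (K z) → ∀ x → ConjugatesIn K x
    z∈⇒conjugatesIn z∈ x g = z^ s , multiples-∈ z∈ s , conjugate-by≡z^· g x
      where s = commutator-exponent x g

  _≟_ : DecidableEquality Carrier
  _≟_ = ≡-dec Fin._≟_ Fin._≟_

  Trivial : Subset
  Trivial x = ⌊ x ≟ e ⌋

  Trivial-isSubgroup : IsSubgroup (M n) Trivial
  Trivial-isSubgroup = record
    { has-e   = fromWitness refl
    ; has-·   = λ x y x≡e y≡e → fromWitness (≡.trans (cong₂ _·_ (toWitness x≡e) (toWitness y≡e)) (·-identityˡ e))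
    ; has-inv = λ x x≡e → fromWitness (≡.trans (cong inv (toWitness x≡e)) ε⁻¹≈ε)
    }

  Trivial-normal : IsNormal Trivial
  Trivial-normal g y y≡e = fromWitness (≡.trans (cong (conjugate-by g) (toWitness y≡e)) (conjugate-by-e g))

  z-conjugatesIn-Trivial : ConjugatesIn Trivial z
  z-conjugatesIn-Trivial g = e , fromWitness refl , (begin
    (inv g · z) · g  ≡⟨ ·-assoc (inv g) z g ⟩
    inv g · (z · g)  ≡⟨ cong (λ u → inv g · (u · g)) (sym z^1≡z) ⟩
    inv g · (z^ 1 · g) ≡⟨ cong (inv g ·_) (≡.trans (z^-central 1 g) (cong (g ·_) z^1≡z)) ⟩
    inv g · (g · z)  ≡⟨ \\-leftDividesʳ g z ⟩
    z                ≡⟨ sym (·-identityˡ z) ⟩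
    e · z            ∎)
    where open ≡-Reasoning

  ∣-toℕ-mod⁺₀ : ∀ {d} i → d ∣ N → d ∣ i → d ∣ toℕ (i mod N)
  ∣-toℕ-mod⁺₀ {d} i d∣N d∣i = subst (d ∣_) (sym (toℕ-mod i N)) (%-presˡ-∣ d∣i d∣N)

  ∣-toℕ-mod⁻₀ : ∀ {d} i → d ∣ N → d ∣ toℕ (i mod N) → d ∣ i
  ∣-toℕ-mod⁻₀ {d} i d∣N d∣i%N = ∣n∣m%n⇒∣m d∣N (subst (d ∣_) (toℕ-mod i N) d∣i%N)

  ∣-toℕ-mod⁺ : ∀ {d} i c → d ∣ N → d ∣ i + c → d ∣ toℕ (i mod N) + c
  ∣-toℕ-mod⁺ {d} i c d∣N d∣i+c = ∣m+n∣m⇒∣n (subst (d ∣_) split d∣i+c) (∣n⇒∣m*n (i / N) d∣N)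
    where
      split : i + c ≡ i / N * N + (toℕ (i mod N) + c)
      split = begin
        i + c                           ≡⟨ cong (_+ c) (≡.trans (m≡m%n+[m/n]*n i N) (+-comm (i % N) _)) ⟩
        i / N * N + i % N + c           ≡⟨ +-assoc (i / N * N) _ c ⟩
        i / N * N + (i % N + c)         ≡⟨ cong (λ u → i / N * N + (u + c)) (sym (toℕ-mod i N)) ⟩
        i / N * N + (toℕ (i mod N) + c) ∎
        where open ≡-Reasoning

  ⟨a⟩ : Subset
  ⟨a⟩ (_ , zero)  = true
  ⟨a⟩ (_ , suc _) = false

  -- Hb p = ⟨a^(2^p), b⟩ and Hab p = ⟨a^(2^(p+1)), a^(2^p) b⟩.
  Hb : ℕ → Subset
  Hb p (i , _) = ⌊ 2 ^ p ∣? toℕ i ⌋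

  Hab : ℕ → Subset
  Hab p (i , zero)  = ⌊ 2 ^ suc p ∣? toℕ i ⌋
  Hab p (i , suc _) = ⌊ 2 ^ suc p ∣? toℕ i + 2 ^ p ⌋

  ⟨a⟩-isSubgroup : IsSubgroup (M n) ⟨a⟩
  ⟨a⟩-isSubgroup = record { has-e = _ ; has-· = closed ; has-inv = inverse }
    where
      closed : ∀ x y → T (⟨a⟩ x) → T (⟨a⟩ y) → T (⟨a⟩ (x · y))
      closed (_ , zero) (_ , zero) _ _ = _
      inverse : ∀ x → T (⟨a⟩ x) → T (⟨a⟩ (inv x))
      inverse (_ , zero) _ = _

  inv-∣ : ∀ {d} (i : Fin N) j → d ∣ N → d ∣ toℕ i → d ∣ toℕ (proj₁ (inv (i , j)))
  inv-∣ i j d∣N d∣i = ∣-toℕ-mod⁺₀ _ d∣N (∣-∸ (m%n≤n _ N) d∣N (%-presˡ-∣ (∣m⇒∣m*n _ d∣i) d∣N))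

  Hb-isSubgroup : ∀ {p} → p ≤ 3 + m → IsSubgroup (M n) (Hb p)
  Hb-isSubgroup {p} p≤ = record
    { has-e   = fromWitness (∣-toℕ-mod⁺₀ 0 d∣N (_ ∣0))
    ; has-·   = λ (i , j) (k , l) i∈ k∈ →
                  fromWitness (∣-toℕ-mod⁺₀ _ d∣N (∣m∣n⇒∣m+n (toWitness i∈) (∣m⇒∣m*n _ (toWitness k∈))))
    ; has-inv = λ (i , j) i∈ → fromWitness (inv-∣ i j d∣N (toWitness i∈))
    }
    where
      d∣N : 2 ^ p ∣ N
      d∣N = 2^-monoʳ-∣ p≤

  Hab-isSubgroup : ∀ {p} → p ≤ 2 + m → IsSubgroup (M n) (Hab p)
  Hab-isSubgroup {p} p≤ = record
    { has-e = fromWitness (∣-toℕ-mod⁺₀ 0 d∣N (_ ∣0)) ; has-· = closed ; has-inv = inverse }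
    where
      c d : ℕ
      c = 2 ^ p
      d = 2 ^ suc p
      d∣N : d ∣ N
      d∣N = 2^-monoʳ-∣ (s≤s p≤)
      d∣*h : ∀ {k} → d ∣ k + c → d ∣ k * h
      d∣*h {k} d∣k+c = subst (_∣ k * h) (*-comm c 2) (*-pres-∣ c∣k (m∣m*n q))
        where
          c∣k : c ∣ k
          c∣k = ∣m+n∣m⇒∣n (subst (c ∣_) (+-comm k c) (∣-trans (n∣m*n 2) d∣k+c)) ∣-refl
      closed : ∀ x y → T (Hab p x) → T (Hab p y) → T (Hab p (x · y))
      closed (i , zero) (k , zero) i∈ k∈ =
        fromWitness (∣-toℕ-mod⁺₀ _ d∣N (∣m∣n⇒∣m+n (toWitness i∈) (∣m⇒∣m*n 1 (toWitness k∈))))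
      closed (i , zero) (k , suc zero) i∈ k∈ =
        fromWitness (∣-toℕ-mod⁺ _ c d∣N (subst (d ∣_) (sym (regroup (toℕ i) (toℕ k) c))
          (∣m∣n⇒∣m+n (toWitness i∈) (toWitness k∈))))
        where
          regroup : ∀ i k c → i + k * 1 + c ≡ i + (k + c)
          regroup = solve-∀
      closed (i , suc zero) (k , zero) i∈ k∈ =
        fromWitness (∣-toℕ-mod⁺ _ c d∣N (subst (d ∣_) (sym (regroup (toℕ i) (toℕ k) c r))
          (∣m∣n⇒∣m+n (toWitness i∈) (∣m⇒∣m*n (r * 1) (toWitness k∈)))))
        where
          regroup : ∀ i k c r → i + k * (r * 1) + c ≡ i + c + k * (r * 1)
          regroup = solve-∀
      closed (i , suc zero) (k , suc zero) i∈ k∈ =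
        fromWitness (∣-toℕ-mod⁺₀ _ d∣N (∣m+n∣m⇒∣n (subst (d ∣_) (regroup (toℕ i) (toℕ k) c h)
          (∣m∣n⇒∣m+n (∣m∣n⇒∣m+n (toWitness i∈) (toWitness k∈)) (d∣*h (toWitness k∈)))) ∣-refl))
        where
          regroup : ∀ i k c h → i + c + (k + c) + k * h ≡ 2 * c + (i + k * ((1 + h) * 1))
          regroup = solve-∀
      inverse-square : ∀ x → T (Hab p x) → T (Hab p (inv (x · x)))
      inverse-square x@(_ , zero)     x∈ = fromWitness (inv-∣ (proj₁ (x · x)) zero d∣N (toWitness (closed x x x∈ x∈)))
      inverse-square x@(_ , suc zero) x∈ = fromWitness (inv-∣ (proj₁ (x · x)) zero d∣N (toWitness (closed x x x∈ x∈)))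
      -- Squares lie in ⟨a⟩, where inverses are handled by inv-∣.
      inverse : ∀ x → T (Hab p x) → T (Hab p (inv x))
      inverse x x∈ = subst (T ∘ Hab p) (sym (inv≡·inv-square x)) (closed x _ x∈ (inverse-square x x∈))

  a : Carrier
  a = mk 1 0

  1<N : 1 < N
  1<N = ∣⇒≤ (2^-monoʳ-∣ {1} {3 + m} (s≤s z≤n))

  conjugate-by-a : ∀ (i : Fin N) j → conjugate-by a (i , j) ≡ mk (toℕ i + toℕ j * h) (toℕ j)
  conjugate-by-a i j = begin
    conjugate-by a (i , j) ≡⟨ conjugate-by≡z^· a (i , j) ⟩
    z^ s · (i , j)         ≡⟨ cong (z^ s ·_) (mk-η i j) ⟩
    mk (s * h) 0 · mk I J  ≡⟨ mul-even (s * h) I J ⟩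
    mk (s * h + I) J       ≡⟨ cong (λ u → mk (u * h + I) J) s≡J ⟩
    mk (J * h + I) J       ≡⟨ cong (λ u → mk u J) (+-comm (J * h) I) ⟩
    mk (I + J * h) J       ∎
    where
      open ≡-Reasoning
      I J s : ℕ
      I = toℕ i ; J = toℕ j
      s = commutator-exponent (i , j) a
      s≡J : s ≡ J
      s≡J = ≡.trans (cong₂ _+_ (≡.trans (cong (_* J) (≡.trans (toℕ-mod 1 N) (m<n⇒m%n≡m 1<N))) (*-identityˡ J))
                               (*-zeroʳ I))
                    (+-identityʳ J)

  conj-a-Hb≐Hab : conj (M n) a (Hb (3 + m)) ≐ Hab (2 + m)
  conj-a-Hb≐Hab = (λ (i , j) → to i j) , (λ (i , j) → from i j)
    where
      N∣ : ∀ i j → T (conj (M n) a (Hb (3 + m)) (i , j)) → N ∣ toℕ i + toℕ j * h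
      N∣ i j t = ∣-toℕ-mod⁻₀ _ ∣-refl (toWitness (subst (T ∘ Hb (3 + m)) (conjugate-by-a i j) t))
      ∣N : ∀ i j → N ∣ toℕ i + toℕ j * h → T (conj (M n) a (Hb (3 + m)) (i , j))
      ∣N i j d = subst (T ∘ Hb (3 + m)) (sym (conjugate-by-a i j)) (fromWitness (∣-toℕ-mod⁺₀ _ ∣-refl d))
      to : ∀ i j → T (conj (M n) a (Hb (3 + m)) (i , j)) → T (Hab (2 + m) (i , j))
      to i zero       t = fromWitness (subst (N ∣_) (+-identityʳ _) (N∣ i zero t))
      to i (suc zero) t = fromWitness (subst (λ u → N ∣ toℕ i + u) (*-identityˡ h) (N∣ i (suc zero) t))
      from : ∀ i j → T (Hab (2 + m) (i , j)) → T (conj (M n) a (Hb (3 + m)) (i , j))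
      from i zero       t = ∣N i zero (subst (N ∣_) (sym (+-identityʳ _)) (toWitness t))
      from i (suc zero) t = ∣N i (suc zero) (subst (λ u → N ∣ toℕ i + u) (sym (*-identityˡ h)) (toWitness t))

  -- Upper bound

  Hb-generator Hab-generator : ℕ → Subset × Subset
  Hb-generator p  = Hb (suc p) , Full
  Hab-generator p = Hab p , Full

  generators : List (Subset × Subset)
  generators = (⟨a⟩ , Full) ∷ applyUpTo Hb-generator (3 + m) ++ applyUpTo Hab-generator (2 + m)

  length-generators : length generators ≡ 2 * (3 + m)
  length-generators = begin
    suc (length (applyUpTo Hb-generator (3 + m) ++ applyUpTo Hab-generator (2 + m)))
      ≡⟨ cong suc (length-++ (applyUpTo Hb-generator (3 + m))) ⟩
    suc (length (applyUpTo Hb-generator (3 + m)) + length (applyUpTo Hab-generator (2 + m)))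
      ≡⟨ cong₂ (λ u v → suc (u + v)) (length-applyUpTo Hb-generator (3 + m))
                                     (length-applyUpTo Hab-generator (2 + m)) ⟩
    suc (3 + m + (2 + m))                                     ≡⟨ count m ⟩
    2 * (3 + m)                                               ∎
    where
      open ≡-Reasoning
      count : ∀ m → suc (3 + m + (2 + m)) ≡ 2 * (3 + m)
      count = solve-∀

  generators-valid : ValidGens (M n) generators
  generators-valid = (⟨a⟩-isSubgroup , Full-isSubgroup , ⊆Full)
    ∷ ++⁺ (applyUpTo⁺₁ Hb-generator (3 + m) λ p< → Hb-isSubgroup p< , Full-isSubgroup , ⊆Full)
          (applyUpTo⁺₁ Hab-generator (2 + m) λ p< → Hab-isSubgroup (<⇒≤ p<) , Full-isSubgroup , ⊆Full)
    where
      ⊆Full : ∀ {K} → K ⊆ Full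
      ⊆Full _ _ = _

  ⟨a⟩→Full : Gen (M n) generators ⟨a⟩ Full
  ⟨a⟩→Full = base (here refl)

  Hb→Full : ∀ {p} → p ≤ 3 + m → Gen (M n) generators (Hb p) Full
  Hb→Full {zero}  _        = resp ((λ _ _ → fromWitness (1∣ _)) , (λ _ _ → _)) ((λ _ x∈ → x∈) , (λ _ x∈ → x∈))
                                  (refl Full-isSubgroup)
  Hb→Full {suc p} (s≤s p≤) = base (there (∈-++⁺ˡ (∈-applyUpTo⁺ Hb-generator (s≤s p≤))))

  Hab→Full : ∀ {p} → p ≤ 2 + m → Gen (M n) generators (Hab p) Full
  Hab→Full p≤ with m<1+n⇒m<n∨m≡n (s≤s p≤)
  ... | inj₁ p<   = base (there (∈-++⁺ʳ (applyUpTo Hb-generator (3 + m)) (∈-applyUpTo⁺ Hab-generator p<)))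
  ... | inj₂ refl = resp conj-a-Hb≐Hab ((λ _ x∈ → x∈) , (λ _ x∈ → x∈)) (conjugate a (Hb→Full ≤-refl))

  elements : List Carrier
  elements = cartesianProduct (allFin N) (allFin 2)

  ∈-elements : ∀ x → x ∈ elements
  ∈-elements (i , j) = ∈-cartesianProduct⁺ (∈-allFin i) (∈-allFin j)

  open Finite elements ∈-elements public

  mk-N≡e : mk N 0 ≡ e
  mk-N≡e = mk-≡ 0 1 0 refl

  module Classification {K : Subset} (sK : IsSubgroup (M n) K) where
    open IsSubgroup sK

    -- K ∩ ⟨a⟩ = ⟨a^(2^p)⟩ for the least p with a^(2^p) ∈ K; p ≤ n - 1 since a^(2^(n-1)) = e.
    -- The search is abstract so that conversion checking never unfolds p, which is very costly.
    abstract
      least-level : ∃[ p ] T (K (mk (2 ^ p) 0)) × (∀ {v} → T (K (mk (2 ^ v) 0)) → p ≤ v)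
      least-level = least-satisfying (λ v → T? (K (mk (2 ^ v) 0))) {3 + m} (subst (T ∘ K) (sym mk-N≡e) has-e)

    p : ℕ
    p = proj₁ least-level

    p-least : ∀ {v} → T (K (mk (2 ^ v) 0)) → p ≤ v
    p-least = proj₂ (proj₂ least-level)

    p≤3+m : p ≤ 3 + m
    p≤3+m = p-least {3 + m} (subst (T ∘ K) (sym mk-N≡e) has-e)

    power-of-two-∈ : ∀ {v} o → v ≤ 3 + m → T (K (mk (2 ^ v * (1 + 2 * o)) 0)) → T (K (mk (2 ^ v) 0))
    power-of-two-∈ {v} o v≤ ∈K with odd-inverse (3 + m ∸ v) o
    ... | t , c , eq = subst (T ∘ K) (mk-≡ 0 c 0 (begin
      t * (2 ^ v * (1 + 2 * o)) + 0 ≡⟨ swap t (2 ^ v) (1 + 2 * o) ⟩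
      2 ^ v * (t * (1 + 2 * o))     ≡⟨ cong (2 ^ v *_) eq ⟩
      2 ^ v * (1 + c * 2 ^ s)       ≡⟨ distribute (2 ^ v) c (2 ^ s) ⟩
      2 ^ v + c * (2 ^ v * 2 ^ s)   ≡⟨ cong (λ u → 2 ^ v + c * u) (sym (^-distribˡ-+-* 2 v s)) ⟩
      2 ^ v + c * 2 ^ (v + s)       ≡⟨ cong (λ u → 2 ^ v + c * 2 ^ u) (m+[n∸m]≡n v≤) ⟩
      2 ^ v + c * N                 ∎)) (multiples-∈ sK ∈K t)
      where
        open ≡-Reasoning
        s : ℕ
        s = 3 + m ∸ v
        swap : ∀ t x u → t * (x * u) + 0 ≡ x * (t * u)
        swap = solve-∀
        distribute : ∀ x c y → x * (1 + c * y) ≡ x + c * (x * y)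
        distribute = solve-∀

    even-mk-∈⁺ : ∀ i → 2 ^ p ∣ i → T (K (mk i 0))
    even-mk-∈⁺ i (divides w refl) = multiples-∈ sK (proj₁ (proj₂ least-level)) w

    even-∈⁺ : ∀ (k : Fin N) → 2 ^ p ∣ toℕ k → T (K (k , zero))
    even-∈⁺ k ∣k = subst (T ∘ K) (sym (mk-η k zero)) (even-mk-∈⁺ (toℕ k) ∣k)

    even-∈⁻ : ∀ (k : Fin N) → T (K (k , zero)) → 2 ^ p ∣ toℕ k
    even-∈⁻ k k∈ with toℕ k in k≡
    ... | zero   = (2 ^ p) ∣0
    ... | suc k′ with two-adic (suc k′) (s≤s z≤n)
    ...   | v , o , k′≡ = subst (2 ^ p ∣_) (sym k′≡) (∣m⇒∣m*n (1 + 2 * o) (2^-monoʳ-∣ p≤v))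
      where
        p≤v : p ≤ v
        p≤v with v ≤? 3 + m
        ... | yes v≤ = p-least (power-of-two-∈ o v≤
                         (subst (T ∘ K) (≡.trans (mk-η k zero) (cong (λ u → mk u 0) (≡.trans k≡ k′≡))) k∈))
        ... | no v≰ = ≤-trans p≤3+m (<⇒≤ (≰⇒> v≰))

    even-mk-∈⁻ : ∀ i → T (K (mk i 0)) → 2 ^ p ∣ i
    even-mk-∈⁻ i i∈ = ∣-toℕ-mod⁻₀ i (2^-monoʳ-∣ p≤3+m) (even-∈⁻ (i mod N) i∈)

    separator-of-≐ : ∀ {C x} → IsSubgroup (M n) C → Gen (M n) generators C Full → K ≐ C → ¬ T (K x) →
                     Separator generators K x
    separator-of-≐ sC C→Full (K⊆C , C⊆K) x∉K =
      record { C-isSubgroup = sC ; K⊆C = K⊆C ; x∉C = x∉K ∘ C⊆K _ ; C→Full = C→Full }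

    separator-without-odd : (∀ c → ¬ T (K (c , suc zero))) → ∀ x → ¬ T (K x) → Separator generators K x
    separator-without-odd no-odd (i , zero) x∉K = record
      { C-isSubgroup = Hb-isSubgroup p≤3+m
      ; K⊆C          = K⊆Hb
      ; x∉C          = λ x∈Hb → x∉K (even-∈⁺ i (toWitness x∈Hb))
      ; C→Full       = Hb→Full p≤3+m
      }
      where
        K⊆Hb : K ⊆ Hb p
        K⊆Hb (k , zero)     k∈ = fromWitness (even-∈⁻ k k∈)
        K⊆Hb (k , suc zero) k∈ = contradiction k∈ (no-odd k)
    separator-without-odd no-odd (i , suc zero) x∉K = record
      { C-isSubgroup = ⟨a⟩-isSubgroup
      ; K⊆C          = K⊆⟨a⟩
      ; x∉C          = λ ()
      ; C→Full       = ⟨a⟩→Full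
      }
      where
        K⊆⟨a⟩ : K ⊆ ⟨a⟩
        K⊆⟨a⟩ (k , zero)     _  = _
        K⊆⟨a⟩ (k , suc zero) k∈ = contradiction k∈ (no-odd k)

    module _ (c : Fin N) (c∈ : T (K (c , suc zero))) where

      odd-∈⁻ : ∀ (k : Fin N) → T (K (k , suc zero)) → 2 ^ p ∣ toℕ k + toℕ c * r
      odd-∈⁻ k k∈ = subst (λ u → 2 ^ p ∣ toℕ k + toℕ c * u) (*-identityʳ r)
                      (even-mk-∈⁻ (toℕ k + toℕ c * (r * 1)) (has-· _ _ k∈ c∈))

      odd-∈⁺ : ∀ (k : Fin N) → 2 ^ p ∣ toℕ k + toℕ c * r → T (K (k , suc zero))
      odd-∈⁺ k ∣k+cr = subst (T ∘ K) (//-rightDividesʳ (c , suc zero) (k , suc zero))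
                         (has-· _ _ (even-mk-∈⁺ _ (subst (λ u → 2 ^ p ∣ toℕ k + toℕ c * u) (sym (*-identityʳ r)) ∣k+cr))
                                    (has-inv _ c∈))

      K≐Hb : 2 ^ p ∣ toℕ c * r → K ≐ Hb p
      K≐Hb ∣cr = K⊆Hb , Hb⊆K
        where
          K⊆Hb : K ⊆ Hb p
          K⊆Hb (k , zero)     k∈ = fromWitness (even-∈⁻ k k∈)
          K⊆Hb (k , suc zero) k∈ = fromWitness (∣m+n∣m⇒∣n (subst (2 ^ p ∣_) (+-comm (toℕ k) _) (odd-∈⁻ k k∈)) ∣cr)
          Hb⊆K : Hb p ⊆ K
          Hb⊆K (k , zero)     k∈ = even-∈⁺ k (toWitness k∈)
          Hb⊆K (k , suc zero) k∈ = odd-∈⁺ k (∣m∣n⇒∣m+n (toWitness k∈) ∣cr)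

      positive-level : ¬ 2 ^ p ∣ toℕ c * r → ∃[ p′ ] p ≡ suc p′
      positive-level ∤cr with p
      ... | zero   = contradiction (1∣ _) ∤cr
      ... | suc p′ = p′ , refl

      module _ {p′} (p≡ : p ≡ suc p′) (∤cr : ¬ 2 ^ p ∣ toℕ c * r) where

        -- c · c = a^(c + c r) ∈ K, and c + c r = 2 c (1 + q) with 1 + q odd.
        2^p′∣c : 2 ^ p′ ∣ toℕ c
        2^p′∣c = ∣-cancel-odd p′ (toℕ c) (2 ^ m)
                   (*-cancelˡ-∣ 2 (subst (λ u → 2 ^ u ∣ 2 * (toℕ c * (1 + 2 * 2 ^ m))) p≡ 2^p∣c+cr))
          where
            c+cr≡ : ∀ c x → c + c * ((1 + 2 * (2 * x)) * 1) ≡ 2 * (c * (1 + 2 * x))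
            c+cr≡ = solve-∀
            2^p∣c+cr : 2 ^ p ∣ 2 * (toℕ c * (1 + 2 * 2 ^ m))
            2^p∣c+cr = subst (2 ^ p ∣_) (c+cr≡ (toℕ c) (2 ^ m)) (even-mk-∈⁻ _ (has-· _ _ c∈ c∈))

        odd-offset : ∃[ w ] toℕ c * r ≡ 2 ^ p′ + w * 2 ^ suc p′
        odd-offset = offset (∣m⇒∣m*n r 2^p′∣c)
          where
            offset : 2 ^ p′ ∣ toℕ c * r → ∃[ w ] toℕ c * r ≡ 2 ^ p′ + w * 2 ^ suc p′
            offset (divides u cr≡) with even-or-odd u
            ... | w , inj₁ refl = contradiction (subst (λ v → 2 ^ v ∣ toℕ c * r) (sym p≡)
                                    (divides w (≡.trans cr≡ (even-quotient w (2 ^ p′))))) ∤cr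
              where
                even-quotient : ∀ w x → 2 * w * x ≡ w * (2 * x)
                even-quotient = solve-∀
            ... | w , inj₂ refl = w , ≡.trans cr≡ (odd-quotient w (2 ^ p′))
              where
                odd-quotient : ∀ w x → (1 + 2 * w) * x ≡ x + w * (2 * x)
                odd-quotient = solve-∀

        K≐Hab : K ≐ Hab p′
        K≐Hab = K⊆Hab , Hab⊆K
          where
            w d : ℕ
            w = proj₁ odd-offset
            d = 2 ^ suc p′
            to-level : ∀ {X} → 2 ^ p ∣ X → d ∣ X
            to-level = subst (λ v → 2 ^ v ∣ _) p≡
            from-level : ∀ {X} → d ∣ X → 2 ^ p ∣ X
            from-level = subst (λ v → 2 ^ v ∣ _) (sym p≡)
            shift : ∀ k → k + toℕ c * r ≡ k + 2 ^ p′ + w * d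
            shift k = ≡.trans (cong (k +_) (proj₂ odd-offset)) (sym (+-assoc k _ _))
            K⊆Hab : K ⊆ Hab p′
            K⊆Hab (k , zero)     k∈ = fromWitness (to-level (even-∈⁻ k k∈))
            K⊆Hab (k , suc zero) k∈ =
              fromWitness (∣m+n∣m⇒∣n (subst (d ∣_) (≡.trans (shift (toℕ k)) (+-comm _ (w * d)))
                                            (to-level (odd-∈⁻ k k∈)))
                                     (n∣m*n w))
            Hab⊆K : Hab p′ ⊆ K
            Hab⊆K (k , zero)     k∈ = even-∈⁺ k (from-level (toWitness k∈))
            Hab⊆K (k , suc zero) k∈ = odd-∈⁺ k (from-level (subst (d ∣_) (sym (shift (toℕ k)))
                                        (∣m∣n⇒∣m+n (toWitness k∈) (n∣m*n w))))

    separator : ∀ x → ¬ T (K x) → Separator generators K x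
    separator x x∉K with any? (λ c → T? (K (c , suc zero)))
    ... | no ∄odd = separator-without-odd (λ c c∈ → ∄odd (c , c∈)) x x∉K
    ... | yes (c , c∈) with 2 ^ p ∣? toℕ c * r
    ...   | yes ∣cr = separator-of-≐ (Hb-isSubgroup p≤3+m) (Hb→Full p≤3+m) (K≐Hb c c∈ ∣cr) x∉K
    ...   | no ∤cr with positive-level c c∈ ∤cr
    ...     | p′ , p≡ = separator-of-≐ (Hab-isSubgroup p′≤) (Hab→Full p′≤) (K≐Hab c c∈ p≡ ∤cr) x∉K
      where
        p′≤ : p′ ≤ 2 + m
        p′≤ = ≤-pred (subst (_≤ 3 + m) p≡ p≤3+m)

  generators-complete : GeneratesComplete (M n) generators
  generators-complete = separators⇒complete λ K sK → Classification.separator sK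

  -- Lower bound

  b : Carrier
  b = mk 0 1

  Index : Set
  Index = Fin 2 × Fin (3 + m)

  floor : Index → Subset
  floor (zero     , zero)  = Trivial
  floor (suc zero , zero)  = ⟨a⟩
  floor (zero     , suc t) = Hb (suc (toℕ t))
  floor (suc zero , suc t) = Hab (toℕ t)

  escapee : Index → Carrier
  escapee (_        , suc t) = mk (2 ^ toℕ t) 0
  escapee (zero     , zero)  = z
  escapee (suc zero , zero)  = b

  t≤1+m : ∀ (t : Fin (2 + m)) → toℕ t ≤ 1 + m
  t≤1+m t = ≤-pred (toℕ<n t)

  floor-isSubgroup : ∀ i → IsSubgroup (M n) (floor i)
  floor-isSubgroup (zero     , zero)  = Trivial-isSubgroup
  floor-isSubgroup (suc zero , zero)  = ⟨a⟩-isSubgroup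
  floor-isSubgroup (zero     , suc t) = Hb-isSubgroup (s≤s (m≤n⇒m≤1+n (t≤1+m t)))
  floor-isSubgroup (suc zero , suc t) = Hab-isSubgroup (m≤n⇒m≤1+n (t≤1+m t))

  2^suc-t∣N : ∀ (t : Fin (2 + m)) → 2 ^ suc (toℕ t) ∣ N
  2^suc-t∣N t = 2^-monoʳ-∣ (s≤s (m≤n⇒m≤1+n (t≤1+m t)))

  even-∈-floor : ∀ v t {i} → 2 ^ suc (toℕ t) ∣ i → T (floor (v , suc t) (mk i 0))
  even-∈-floor zero       t {i} ∣i = fromWitness (∣-toℕ-mod⁺₀ i (2^suc-t∣N t) ∣i)
  even-∈-floor (suc zero) t {i} ∣i = fromWitness (∣-toℕ-mod⁺₀ i (2^suc-t∣N t) ∣i)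

  even-∈-floor⁻ : ∀ v t {i} → T (floor (v , suc t) (mk i 0)) → 2 ^ suc (toℕ t) ∣ i
  even-∈-floor⁻ zero       t {i} i∈ = ∣-toℕ-mod⁻₀ i (2^suc-t∣N t) (toWitness i∈)
  even-∈-floor⁻ (suc zero) t {i} i∈ = ∣-toℕ-mod⁻₀ i (2^suc-t∣N t) (toWitness i∈)

  z∈floor : ∀ v t → T (floor (v , suc t) z)
  z∈floor v t = even-∈-floor v t {h} (2^-monoʳ-∣ {k = 2 + m} (s≤s (t≤1+m t)))

  floor-normal : ∀ i → IsNormal (floor i)
  floor-normal (zero     , zero)  = Trivial-normal
  floor-normal (suc zero , zero)  = z∈⇒normal ⟨a⟩-isSubgroup _
  floor-normal i@(v      , suc t) = z∈⇒normal (floor-isSubgroup i) (z∈floor v t)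

  escapee-conjugates : ∀ i → ConjugatesIn (floor i) (escapee i)
  escapee-conjugates (zero     , zero)  = z-conjugatesIn-Trivial
  escapee-conjugates (suc zero , zero)  = z∈⇒conjugatesIn ⟨a⟩-isSubgroup _ b
  escapee-conjugates i@(v      , suc t) = z∈⇒conjugatesIn (floor-isSubgroup i) (z∈floor v t) (escapee i)

  escapee∉floor : ∀ i → ¬ T (floor i (escapee i))
  escapee∉floor (zero     , zero)  z≡e = 2^suc∤2^ (2 + m) (∣-toℕ-mod⁻₀ h ∣-refl (toWitness z∈Hb))
    where
      z∈Hb : T (Hb (3 + m) z)
      z∈Hb = subst (T ∘ Hb (3 + m)) (sym (toWitness z≡e)) (IsSubgroup.has-e (Hb-isSubgroup ≤-refl))
  escapee∉floor (suc zero , zero)  ()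
  escapee∉floor (v        , suc t) a^2^t∈ = 2^suc∤2^ (toℕ t) (even-∈-floor⁻ v t a^2^t∈)

  cover : ∀ i → ∃[ H ] IsSubgroup (M n) H × floor i ⊆ H × T (H (escapee i))
  cover (zero     , zero)  = ⟨a⟩ , ⟨a⟩-isSubgroup , (λ x x≡e → subst (T ∘ ⟨a⟩) (sym (toWitness x≡e)) _) , _
  cover (suc zero , zero)  = Full , Full-isSubgroup , (λ _ _ → _) , _
  cover (v        , suc t) = Hb (toℕ t) , Hb-isSubgroup t≤ , floor⊆Hb v ,
                             fromWitness (∣-toℕ-mod⁺₀ _ (2^-monoʳ-∣ t≤) ∣-refl)
    where
      t≤ : toℕ t ≤ 3 + m
      t≤ = m≤n⇒m≤1+n (m≤n⇒m≤1+n (t≤1+m t))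
      halve : ∀ {i} → 2 ^ suc (toℕ t) ∣ i → 2 ^ toℕ t ∣ i
      halve = ∣-trans (n∣m*n 2)
      floor⊆Hb : ∀ v → floor (v , suc t) ⊆ Hb (toℕ t)
      floor⊆Hb zero       (i , _)        i∈ = fromWitness (halve (toWitness i∈))
      floor⊆Hb (suc zero) (i , zero)     i∈ = fromWitness (halve (toWitness i∈))
      floor⊆Hb (suc zero) (i , suc zero) i∈ =
        fromWitness (∣m+n∣m⇒∣n (subst (2 ^ toℕ t ∣_) (+-comm (toℕ i) (2 ^ toℕ t)) (halve (toWitness i∈))) ∣-refl)

  Hb∪Hab⊆⇒a^2^t∈ : ∀ {K} → IsSubgroup (M n) K → ∀ t → Hb (suc (toℕ t)) ⊆ K → Hab (toℕ t) ⊆ K →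
                   T (K (mk (2 ^ toℕ t) 0))
  Hb∪Hab⊆⇒a^2^t∈ {K} sK t Hb⊆K Hab⊆K =
    subst (T ∘ K) (≡.trans (mul-odd (2 ^ toℕ t) 0 1) (cong (λ u → mk u 0) (+-identityʳ _)))
      (IsSubgroup.has-· sK (mk (2 ^ toℕ t) 1) b (Hab⊆K _ a^2^t·b∈Hab) (Hb⊆K b b∈Hb))
    where
      d∣N : 2 ^ suc (toℕ t) ∣ N
      d∣N = 2^suc-t∣N t
      b∈Hb : T (Hb (suc (toℕ t)) b)
      b∈Hb = fromWitness (∣-toℕ-mod⁺₀ 0 d∣N (_ ∣0))
      a^2^t·b∈Hab : T (Hab (toℕ t) (mk (2 ^ toℕ t) 1))
      a^2^t·b∈Hab = fromWitness (∣-toℕ-mod⁺ (2 ^ toℕ t) _ d∣N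
                      (subst (2 ^ suc (toℕ t) ∣_) (cong (2 ^ toℕ t +_) (+-identityʳ _)) ∣-refl))

  same-level : ∀ {K} → IsSubgroup (M n) K → ∀ v v′ t → floor (v , suc t) ⊆ K → floor (v′ , suc t) ⊆ K →
               ¬ T (K (mk (2 ^ toℕ t) 0)) → (v , suc t) ≡ (v′ , suc t)
  same-level sK zero       zero       t _ _ _ = refl
  same-level sK (suc zero) (suc zero) t _ _ _ = refl
  same-level sK zero       (suc zero) t Hb⊆K Hab⊆K ∉K = contradiction (Hb∪Hab⊆⇒a^2^t∈ sK t Hb⊆K Hab⊆K) ∉K
  same-level sK (suc zero) zero       t Hab⊆K Hb⊆K ∉K = contradiction (Hb∪Hab⊆⇒a^2^t∈ sK t Hb⊆K Hab⊆K) ∉K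

  -- z lies in every floor except Trivial, ⟨a⟩ contains every a^(2^t), and the level-t floors
  -- contain a^(2^t′) for t < t′.
  disjoint : ∀ {i j K} → IsSubgroup (M n) K → floor i ⊆ K → floor j ⊆ K →
             ¬ T (K (escapee i)) → ¬ T (K (escapee j)) → i ≡ j
  disjoint {zero , zero}     {zero , zero}     _ _ _ _ _ = refl
  disjoint {zero , zero}     {suc zero , zero} _ _ F′ z∉ _ = contradiction (F′ z _) z∉
  disjoint {zero , zero}     {v , suc t}       _ _ F′ z∉ _ = contradiction (F′ z (z∈floor v t)) z∉
  disjoint {suc zero , zero} {zero , zero}     _ F _ _ z∉ = contradiction (F z _) z∉
  disjoint {suc zero , zero} {suc zero , zero} _ _ _ _ _ = refl
  disjoint {suc zero , zero} {v , suc t}       _ F _ _ e∉ = contradiction (F _ _) e∉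
  disjoint {v , suc t}       {zero , zero}     _ F _ _ z∉ = contradiction (F z (z∈floor v t)) z∉
  disjoint {v , suc t}       {suc zero , zero} _ _ F′ e∉ _ = contradiction (F′ _ _) e∉
  disjoint {v , suc t}       {v′ , suc t′}     sK F F′ e∉ e′∉ with <-cmp (toℕ t) (toℕ t′)
  ... | tri< t<t′ _ _ = contradiction (F _ (even-∈-floor v t (2^-monoʳ-∣ t<t′))) e′∉
  ... | tri> _ _ t′<t = contradiction (F′ _ (even-∈-floor v′ t′ (2^-monoʳ-∣ t′<t))) e∉
  ... | tri≈ _ t≡t′ _ with toℕ-injective t≡t′
  ...   | refl = same-level sK v v′ t F F′ e∉

  remQuot-injective : Injective _≡_ _≡_ (remQuot {2} (3 + m))
  remQuot-injective {x} {y} eq = begin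
    x                                       ≡⟨ sym (combine-remQuot {2} (3 + m) x) ⟩
    uncurry combine (remQuot {2} (3 + m) x) ≡⟨ cong (uncurry combine) eq ⟩
    uncurry combine (remQuot {2} (3 + m) y) ≡⟨ combine-remQuot {2} (3 + m) y ⟩
    y                                       ∎
    where open ≡-Reasoning

  M-obstructions : Obstructions Index
  M-obstructions = record
    { floor              = floor
    ; escapee            = escapee
    ; floor-isSubgroup   = floor-isSubgroup
    ; floor-normal       = floor-normal
    ; escapee-conjugates = escapee-conjugates
    ; escapee∉floor      = escapee∉floor
    ; cover              = cover
    ; disjoint           = disjoint
    }

  M-width : HasWidth (M n) (2 * (3 + m))
  M-width = (generators , generators-valid , generators-complete , length-generators) ,
            λ S valid complete → obstructions⇒≤ M-obstructions (remQuot (3 + m)) remQuot-injective valid complete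

theoremC : ∀ (n : ℕ) → 4 ≤ n → HasWidth (M n) (2 * (n ∸ 1))
theoremC _ (s≤s (s≤s (s≤s (s≤s {n = m} _)))) = ModularGroup.M-width m
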